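{- For every $\sigma\in Av(T_2)$, the number of ascents of $\sigma$ equals the number of peaks (occurrences of the factor $UD$) of the Dyck prefix $\Phi_2(\sigma)$.
   Context: A permutation $\sigma$ avoids $\tau$ if no subsequence of $\sigma$ has the same relative order as $\tau$. $T_2=\{3124,3142,4123,4132\}$, $Av(T_2)$ is the set of permutations avoiding all four patterns, $S_n(T_2)=Av(T_2)\cap S_n$. An ascent of $\sigma$ is a position $i$ with $\sigma(i)<\sigma(i+1)$. A Dyck prefix is a lattice path from the origin with steps $U=(1,1)$, $D=(1,-1)$ never going below the $x$-axis (a word in $U,D$). The map $\Phi_2$ on $Av(T_2)$: $\Phi_2(1)$ is the empty path; for $n\ge1$ and $\sigma\in S_{n+1}(T_2)$, write $\sigma=M_1w_1\cdots M_kw_k$ with $M_1<\cdots<M_k=n+1$ the left-to-right maxima (entries larger than all preceding ones) and $w_i$ possibly empty words of lengths $l_i$, $M_0=0$. If $w_k$ is empty, $\Phi_2(\sigma)=U^{M_1-M_0}D^{l_1+1}\cdots U^{M_{k-1}-M_{k-2}}D^{l_{k-1}+1}$; if $w_k=x_1\cdots x_{l_k}$ is nonempty, $\Phi_2(\sigma)=U^{M_1-M_0}D^{l_1+1}\cdots U^{M_{k-1}-M_{k-2}}D^{l_{k-1}+1}U^{M_k-M_{k-1}}Q_1\cdots Q_{l_k-1}$ with $Q_j=U$ if $x_j=\max\{x_j,\dots,x_{l_k}\}$ and $Q_j=D$ otherwise. -}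

module Defs where

open import Data.Nat using (ℕ; zero; suc; _+_; _<_; _≤_; _⊔_; _<?_; _≤?_)
open import Data.List using (List; []; _∷_; length; map; upTo; reverse; replicate; _++_; foldr)
open import Data.List.Relation.Binary.Sublist.Propositional using (_⊆_)
open import Data.List.Relation.Binary.Permutation.Propositional using (_↭_)
open import Data.Product using (_×_; _,_; ∃)
open import Data.Bool using (if_then_else_)
open import Relation.Nullary using (¬_)
open import Relation.Nullary.Decidable using (⌊_⌋)
open import Relation.Binary.PropositionalEquality using (_≡_)
open import Function.Bundles using (_⇔_)

IsPerm : List ℕ → Set
IsPerm σ = σ ↭ map suc (upTo (length σ))

-- i-th entry (0-based), default 0 out of range.
at : List ℕ → ℕ → ℕ
at []       _       = 0
at (x ∷ _)  zero    = x
at (_ ∷ xs) (suc i) = at xs i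

OrderIso : List ℕ → List ℕ → Set
OrderIso s τ = (length s ≡ length τ) ×
  (∀ i j → i < length s → j < length s → (at s i < at s j) ⇔ (at τ i < at τ j))

Contains : List ℕ → List ℕ → Set
Contains σ τ = ∃ λ s → (s ⊆ σ) × OrderIso s τ

Avoids : List ℕ → List ℕ → Set
Avoids σ τ = ¬ Contains σ τ

AvT2 : List ℕ → Set
AvT2 σ = Avoids σ (3 ∷ 1 ∷ 2 ∷ 4 ∷ []) × Avoids σ (3 ∷ 1 ∷ 4 ∷ 2 ∷ [])
       × Avoids σ (4 ∷ 1 ∷ 2 ∷ 3 ∷ []) × Avoids σ (4 ∷ 1 ∷ 3 ∷ 2 ∷ [])

ascents : List ℕ → ℕ
ascents (x ∷ y ∷ r) = (if ⌊ x <? y ⌋ then 1 else 0) + ascents (y ∷ r)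
ascents _ = 0

data Step : Set where
  U D : Step

peaks : List Step → ℕ
peaks (U ∷ D ∷ r) = suc (peaks (D ∷ r))
peaks (_ ∷ r)     = peaks r
peaks []          = 0

-- decomposition σ = M₁ w₁ ⋯ M_k w_k by left-to-right maxima
-- go M w xs : current maximum M, current word w (reversed), rest xs
blocksGo : ℕ → List ℕ → List ℕ → List (ℕ × List ℕ)
blocksGo M w []       = (M , reverse w) ∷ []
blocksGo M w (x ∷ xs) = if ⌊ M <? x ⌋ then (M , reverse w) ∷ blocksGo x [] xs
                                       else blocksGo M (x ∷ w) xs

blocks : List ℕ → List (ℕ × List ℕ)
blocks []       = []
blocks (x ∷ xs) = blocksGo x [] xs

-- Q_1 ⋯ Q_{l-1} for the last word x_1 ⋯ x_l :
-- Q_j = U iff x_j = max{x_j, …, x_l}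
Qs : List ℕ → List Step
Qs []              = []
Qs (x ∷ [])        = []
Qs (x ∷ y ∷ ys)    = (if ⌊ foldr _⊔_ 0 (y ∷ ys) ≤? x ⌋ then U else D) ∷ Qs (y ∷ ys)

-- prev = M_{i-1}; remaining blocks (M_i,w_i),…,(M_k,w_k)
phiGo : ℕ → List (ℕ × List ℕ) → List Step
phiGo prev []                  = []
phiGo prev ((M , []) ∷ [])     = []
phiGo prev ((M , w@(_ ∷ _)) ∷ []) = replicate (M Data.Nat.∸ prev) U ++ Qs w
phiGo prev ((M , w) ∷ rest@(_ ∷ _)) =
  replicate (M Data.Nat.∸ prev) U ++ replicate (suc (length w)) D ++ phiGo M rest

-- Φ₂ (on permutations of size ≥ 1; Φ₂(1) = empty path)
Φ₂ : List ℕ → List Step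
Φ₂ σ = phiGo 0 (blocks σ)

module Submission where

open import Defs
open import Data.Nat using (ℕ; _≤_)
open import Data.List using (List; length)
open import Relation.Binary.PropositionalEquality using (_≡_)

open import Data.Nat using (zero; suc; pred; _<_; _<?_; _≤?_; _⊔_; _∸_; z≤n; s≤s)
open import Data.Nat.Properties
  using (<-trans; <-irrefl; <-asym; <-cmp; ≤-trans; ≤-<-trans; <⇒≤; <⇒≱; ≮⇒≥; ≰⇒>; ≤∧≢⇒<;
         m≤m⊔n; ⊔-lub; m<n⇒0<n∸m; suc-injective)
open import Data.List using ([]; _∷_; _++_; _ʳ++_; reverse; replicate; foldr; map)
open import Data.List.Properties using (length-map; ʳ++-defn)
open import Data.List.Relation.Unary.All as All using (All; []; _∷_)
open import Data.List.Relation.Unary.AllPairs using ([]; _∷_)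
open import Data.List.Relation.Unary.Any using (here; there)
open import Data.List.Relation.Unary.Linked as Linked using (Linked; []; [-]; _∷_)
open import Data.List.Relation.Unary.Unique.Propositional using (Unique)
import Data.List.Relation.Unary.Unique.Propositional.Properties as Unique
open import Data.List.Membership.Propositional using (_∈_)
open import Data.List.Membership.Propositional.Properties using (∈-map⁻)
open import Data.List.Relation.Binary.Sublist.Propositional
  using (_⊆_; []; _∷_; _∷ʳ_; ⊆-refl; ⊆-trans; from∈)
open import Data.List.Relation.Binary.Sublist.Propositional.Properties
  using ([]⊆-universal; ++⁺; ++⁺ˡ; All-resp-⊆)
open import Data.List.Relation.Binary.Permutation.Propositional using (↭-sym; ↭⇒↭ₛ)
open import Data.List.Relation.Binary.Permutation.Propositional.Properties
  using (∈-resp-↭; All-resp-↭; ↭-reverse)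
open import Data.List.Relation.Binary.Permutation.Setoid.Properties using (Unique-resp-↭)
open import Data.Product using (_,_; proj₁; proj₂; _×_)
open import Data.Empty using (⊥; ⊥-elim)
open import Relation.Nullary using (¬_; Dec; yes; no; contradiction)
open import Relation.Nullary.Decidable using (_×-dec_; from-yes)
open import Relation.Binary.Definitions using (tri<; tri≈; tri>)
open import Relation.Binary.PropositionalEquality
  using (refl; sym; trans; cong; subst; subst₂; _≢_; setoid; module ≡-Reasoning)
open import Function using (_∘_)
open import Function.Bundles using (_⇔_; mk⇔)

-- Write σ = M₁w₁⋯M_kw_k by its left-to-right maxima; both the
-- ascents of σ and the peaks of Φ₂(σ) can be counted block by block.
--  * An inner block M_iw_i (i < k) is followed by M_{i+1} > M_i.  As σ avoids
--    3124, the word M_iw_i is non-increasing, so it contributes exactly one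
--    ascent (into M_{i+1}), and its path U^{M_i-M_{i-1}}D^{l_i+1} one peak.
--  * In the last block M_kw_k, as σ avoids 4123 and 4132, no entry of w_k is
--    followed by two larger entries; under this condition asc(w_k) equals the
--    number of peaks of U Q₁⋯Q_{l_k-1}, and U^{M_k-M_{k-1}} may replace that U.

at-map : ∀ (f : ℕ → ℕ) xs {i} → i < length xs → at (map f xs) i ≡ f (at xs i)
at-map f (x ∷ xs) {zero}  _         = refl
at-map f (x ∷ xs) {suc i} (s≤s i<n) = at-map f xs i<n

at-∈ : ∀ (xs : List ℕ) {i} → i < length xs → at xs i ∈ xs
at-∈ (x ∷ xs) {zero}  _         = here refl
at-∈ (x ∷ xs) {suc i} (s≤s i<n) = there (at-∈ xs i<n)

map-orderIso : ∀ (f : ℕ → ℕ) τ → (∀ {x y} → x ∈ τ → y ∈ τ → x < y → f x < f y) →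
               OrderIso (map f τ) τ
map-orderIso f τ mono = length-map f τ , λ i j i<n j<n →
  let i<n′ = subst (i <_) (length-map f τ) i<n
      j<n′ = subst (j <_) (length-map f τ) j<n
  in subst₂ (λ u v → (u < v) ⇔ (at τ i < at τ j))
            (sym (at-map f τ i<n′)) (sym (at-map f τ j<n′))
            (reflects (at-∈ τ i<n′) (at-∈ τ j<n′))
  where
  reflects : ∀ {x y} → x ∈ τ → y ∈ τ → (f x < f y) ⇔ (x < y)
  reflects {x} {y} x∈τ y∈τ = mk⇔ to (mono x∈τ y∈τ)
    where
    to : f x < f y → x < y
    to fx<fy with <-cmp x y
    ... | tri< x<y _ _  = x<y
    ... | tri≈ _ refl _ = ⊥-elim (<-irrefl refl fx<fy)
    ... | tri> _ _ y<x  = ⊥-elim (<-asym fx<fy (mono y∈τ x∈τ y<x))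

at-increasing : ∀ {ρ i j} → Linked _<_ ρ → i < j → j < length ρ → at ρ i < at ρ j
at-increasing {_ ∷ _ ∷ _} {zero} {suc zero} (x<y ∷ _) _ _ = x<y
at-increasing {_ ∷ _ ∷ _} {zero} {suc (suc j)} (x<y ∷ inc) _ (s≤s j<n) =
  <-trans x<y (at-increasing inc (s≤s z≤n) j<n)
at-increasing {_ ∷ _} {suc i} {suc j} inc (s≤s i<j) (s≤s j<n) =
  at-increasing (Linked.tail inc) i<j j<n

-- The value x of a pattern, relabelled as the x-th entry of ρ.
relabel : List ℕ → ℕ → ℕ
relabel ρ x = at ρ (pred x)

relabel-mono : ∀ {ρ x y} → Linked _<_ ρ → 1 ≤ x → x < y → y ≤ length ρ →
               relabel ρ x < relabel ρ y
relabel-mono {x = suc x} {suc y} inc _ (s≤s x<y) y≤n = at-increasing inc x<y y≤n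

ValuesIn : ℕ → List ℕ → Set
ValuesIn k = All (λ x → 1 ≤ x × x ≤ k)

valuesIn? : ∀ k τ → Dec (ValuesIn k τ)
valuesIn? k = All.all? (λ x → (1 ≤? x) ×-dec (x ≤? k))

contains-relabel : ∀ {σ} τ {ρ} → Linked _<_ ρ → ValuesIn (length ρ) τ →
                   map (relabel ρ) τ ⊆ σ → Contains σ τ
contains-relabel τ {ρ} inc values sub = map (relabel ρ) τ , sub , map-orderIso (relabel ρ) τ mono
  where
  mono : ∀ {x y} → x ∈ τ → y ∈ τ → x < y → relabel ρ x < relabel ρ y
  mono x∈τ y∈τ x<y =
    relabel-mono inc (proj₁ (All.lookup values x∈τ)) x<y (proj₂ (All.lookup values y∈τ))

unique-pair : ∀ {A : Set} {a b : A} {xs} → Unique xs → (a ∷ b ∷ []) ⊆ xs → a ≢ b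
unique-pair (_ ∷ u)      (_ ∷ʳ s)   = unique-pair u s
unique-pair (a≢xs ∷ _)  (refl ∷ s) = All.head (All-resp-⊆ s a≢xs)

All-reverse : ∀ {A : Set} {P : A → Set} w → All P w → All P (reverse w)
All-reverse w = All-resp-↭ (↭-sym (↭-reverse w))

perm-unique : ∀ {σ} → IsPerm σ → Unique σ
perm-unique {σ} perm =
  Unique-resp-↭ (setoid ℕ) (↭⇒↭ₛ (↭-sym perm)) (Unique.map⁺ suc-injective (Unique.upTo⁺ (length σ)))

-- Entries of a permutation of 1, …, n are positive (so M₀ = 0 < M₁).
perm-positive : ∀ {x xs} → IsPerm (x ∷ xs) → 0 < x
perm-positive perm with ∈-map⁻ suc (∈-resp-↭ perm (here refl))
... | _ , _ , refl = s≤s z≤n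

ascents-rise : ∀ {a b} r → a < b → ascents (a ∷ b ∷ r) ≡ suc (ascents (b ∷ r))
ascents-rise {a} {b} r a<b with a <? b
... | yes _   = refl
... | no a≮b = contradiction a<b a≮b

ascents-fall : ∀ {a b} r → b ≤ a → ascents (a ∷ b ∷ r) ≡ ascents (b ∷ r)
ascents-fall {a} {b} r b≤a with a <? b
... | yes a<b = contradiction b≤a (<⇒≱ a<b)
... | no _    = refl

NonIncreasing : List ℕ → Set
NonIncreasing r = ∀ {a b} → (a ∷ b ∷ []) ⊆ r → b ≤ a

ascents-run : ∀ a r {y} ys → NonIncreasing (a ∷ r) → All (_< y) (a ∷ r) →
              ascents ((a ∷ r) ++ y ∷ ys) ≡ suc (ascents (y ∷ ys))
ascents-run a []      ys _   (a<y ∷ []) = ascents-rise ys a<y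
ascents-run a (b ∷ r) {y} ys dec (_ ∷ r<y) =
  trans (ascents-fall (r ++ y ∷ ys) (dec (refl ∷ refl ∷ []⊆-universal r)))
        (ascents-run b r ys (dec ∘ (a ∷ʳ_)) r<y)

peaks-rise : ∀ m q → 0 < m → peaks (replicate m U ++ q) ≡ peaks (U ∷ q)
peaks-rise (suc zero)    q _ = refl
peaks-rise (suc (suc m)) q _ = peaks-rise (suc m) q (s≤s z≤n)

peaks-fall : ∀ l q → peaks (replicate l D ++ q) ≡ peaks q
peaks-fall zero    q = refl
peaks-fall (suc l) q = peaks-fall l q

peaks-mountain : ∀ m l q → 0 < m → peaks (replicate m U ++ replicate (suc l) D ++ q) ≡ suc (peaks q)
peaks-mountain m l q 0<m = trans (peaks-rise m _ 0<m) (cong suc (peaks-fall l q))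

max-lub : ∀ {k} {l : List ℕ} → All (_≤ k) l → foldr _⊔_ 0 l ≤ k
max-lub []            = z≤n
max-lub (x≤k ∷ l≤k) = ⊔-lub x≤k (max-lub l≤k)

-- If b is at least every later entry, Q(b r) starts with U (or is empty),
-- so a preceding U creates no peak.
peaks-U-dominant : ∀ b r → All (_≤ b) r → peaks (U ∷ Qs (b ∷ r)) ≡ peaks (Qs (b ∷ r))
peaks-U-dominant b []      _   = refl
peaks-U-dominant b (c ∷ r) r≤b with foldr _⊔_ 0 (c ∷ r) ≤? b
... | yes _     = refl
... | no max≰b = contradiction (max-lub r≤b) max≰b

-- If some later entry exceeds b, Q(b r) starts with D, so a preceding U
-- creates a peak.
peaks-U-dominated : ∀ b r → ¬ (foldr _⊔_ 0 r ≤ b) → peaks (U ∷ Qs (b ∷ r)) ≡ suc (peaks (Qs (b ∷ r)))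
peaks-U-dominated b []      max≰b = contradiction z≤n max≰b
peaks-U-dominated b (c ∷ r) max≰b with foldr _⊔_ 0 (c ∷ r) ≤? b
... | yes max≤b = contradiction max≤b max≰b
... | no _      = refl

-- No entry of r is followed by two larger entries: once p is followed by a
-- larger q, no later z exceeds p.
NoTwoLarger : List ℕ → Set
NoTwoLarger r = ∀ {p q z} → (p ∷ q ∷ z ∷ []) ⊆ r → p < q → z ≤ p

ascents-lastWord : ∀ a r → NoTwoLarger (a ∷ r) → ascents (a ∷ r) ≡ peaks (U ∷ Qs (a ∷ r))
ascents-lastWord a []      _   = refl
ascents-lastWord a (b ∷ r) ntl with foldr _⊔_ 0 (b ∷ r) ≤? a | a <? b
... | yes max≤a | yes a<b = contradiction (≤-trans (m≤m⊔n b _) max≤a) (<⇒≱ a<b)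
... | yes _     | no _    = ascents-lastWord b r (ntl ∘ (a ∷ʳ_))
... | no _      | yes a<b =
  cong suc (trans (ascents-lastWord b r (ntl ∘ (a ∷ʳ_))) (peaks-U-dominant b r r≤b))
  where
  r≤b : All (_≤ b) r
  r≤b = All.tabulate (λ e∈r → ≤-trans (ntl (refl ∷ refl ∷ from∈ e∈r) a<b) (<⇒≤ a<b))
... | no max≰a  | no a≮b  =
  trans (ascents-lastWord b r (ntl ∘ (a ∷ʳ_))) (peaks-U-dominated b r max≰b)
  where
  max≰b : ¬ (foldr _⊔_ 0 r ≤ b)
  max≰b max≤b = max≰a (⊔-lub (≮⇒≥ a≮b) (≤-trans max≤b (≮⇒≥ a≮b)))

blocksGo-nonempty : ∀ M w xs → blocksGo M w xs ≢ []
blocksGo-nonempty M w []       ()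
blocksGo-nonempty M w (x ∷ xs) with M <? x
... | yes _ = λ ()
... | no _  = blocksGo-nonempty M (x ∷ w) xs

peaks-inner-block : ∀ {prev M} w rest → prev < M → rest ≢ [] →
                    peaks (phiGo prev ((M , w) ∷ rest)) ≡ suc (peaks (phiGo M rest))
peaks-inner-block w []       _      rest≢[] = contradiction refl rest≢[]
peaks-inner-block {prev} {M} [] (b ∷ rest) prev<M _ =
  peaks-mountain (M ∸ prev) 0 (phiGo M (b ∷ rest)) (m<n⇒0<n∸m prev<M)
peaks-inner-block {prev} {M} w@(_ ∷ _) (b ∷ rest) prev<M _ =
  peaks-mountain (M ∸ prev) (length w) (phiGo M (b ∷ rest)) (m<n⇒0<n∸m prev<M)

peaks-last-block : ∀ {prev M} r → prev < M → All (_≤ M) r → NoTwoLarger r →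
                   peaks (phiGo prev ((M , r) ∷ [])) ≡ ascents (M ∷ r)
peaks-last-block []      _      _          _   = refl
peaks-last-block {prev} {M} (a ∷ r) prev<M (a≤M ∷ _) ntl = begin
  peaks (phiGo prev ((M , a ∷ r) ∷ [])) ≡⟨ peaks-rise (M ∸ prev) (Qs (a ∷ r)) (m<n⇒0<n∸m prev<M) ⟩
  peaks (U ∷ Qs (a ∷ r))                ≡⟨ sym (ascents-lastWord a r ntl) ⟩
  ascents (a ∷ r)                        ≡⟨ sym (ascents-fall r a≤M) ⟩
  ascents (M ∷ a ∷ r)                    ∎
  where open ≡-Reasoning

module InAvT2 {σ : List ℕ}
  (avoids3124 : Avoids σ (3 ∷ 1 ∷ 2 ∷ 4 ∷ []))
  (avoids4123 : Avoids σ (4 ∷ 1 ∷ 2 ∷ 3 ∷ []))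
  (avoids4132 : Avoids σ (4 ∷ 1 ∷ 3 ∷ 2 ∷ []))
  (unique : Unique σ)
  where

  no3124 : ∀ {p q r t} → p < q → q < r → r < t → (r ∷ p ∷ q ∷ t ∷ []) ⊆ σ → ⊥
  no3124 p<q q<r r<t = avoids3124 ∘ contains-relabel (3 ∷ 1 ∷ 2 ∷ 4 ∷ []) (p<q ∷ q<r ∷ r<t ∷ [-])
                                       (from-yes (valuesIn? 4 (3 ∷ 1 ∷ 2 ∷ 4 ∷ [])))

  no4123 : ∀ {p q r t} → p < q → q < r → r < t → (t ∷ p ∷ q ∷ r ∷ []) ⊆ σ → ⊥
  no4123 p<q q<r r<t = avoids4123 ∘ contains-relabel (4 ∷ 1 ∷ 2 ∷ 3 ∷ []) (p<q ∷ q<r ∷ r<t ∷ [-])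
                                       (from-yes (valuesIn? 4 (4 ∷ 1 ∷ 2 ∷ 3 ∷ [])))

  no4132 : ∀ {p q r t} → p < q → q < r → r < t → (t ∷ p ∷ r ∷ q ∷ []) ⊆ σ → ⊥
  no4132 p<q q<r r<t = avoids4132 ∘ contains-relabel (4 ∷ 1 ∷ 3 ∷ 2 ∷ []) (p<q ∷ q<r ∷ r<t ∷ [-])
                                       (from-yes (valuesIn? 4 (4 ∷ 1 ∷ 3 ∷ 2 ∷ [])))

  -- Entries of σ are distinct, so a later entry not above M is below M.
  below : ∀ {M e} → (M ∷ e ∷ []) ⊆ σ → e ≤ M → e < M
  below M,e e≤M = ≤∧≢⇒< e≤M (unique-pair unique M,e ∘ sym)

  -- For entries M p q z of σ (in this order) none above M, p < q forces
  -- z ≤ p: otherwise M p q z is a 4123, a 4132, or repeats an entry.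
  after-rise : ∀ {M p q z} → (M ∷ p ∷ q ∷ z ∷ []) ⊆ σ → q ≤ M → z ≤ M → p < q → z ≤ p
  after-rise {M} {p} {q} {z} s q≤M z≤M p<q with z ≤? p
  ... | yes z≤p = z≤p
  ... | no z≰p with <-cmp q z
  ...   | tri< q<z _ _ = ⊥-elim (no4123 p<q q<z (below (⊆-trans (refl ∷ p ∷ʳ q ∷ʳ refl ∷ []) s) z≤M) s)
  ...   | tri≈ _ q≡z _ = ⊥-elim (unique-pair unique (⊆-trans (M ∷ʳ p ∷ʳ refl ∷ refl ∷ []) s) q≡z)
  ...   | tri> _ _ z<q = ⊥-elim (no4132 (≰⇒> z≰p) z<q (below (⊆-trans (refl ∷ p ∷ʳ refl ∷ z ∷ʳ []) s) q≤M) s)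

  block-noTwoLarger : ∀ {M r} → All (_≤ M) r → (M ∷ r) ⊆ σ → NoTwoLarger r
  block-noTwoLarger r≤M sub s with All-resp-⊆ s r≤M
  ... | _ ∷ q≤M ∷ z≤M ∷ [] = after-rise (⊆-trans (refl ∷ s) sub) q≤M z≤M

  -- A block M r with r ≤ M that is followed later by some x > M is
  -- non-increasing: a rise a < b in r would make M a b x a 3124.
  block-nonIncreasing : ∀ {M r x} xs → All (_≤ M) r → M < x → (M ∷ r ++ x ∷ xs) ⊆ σ →
                        NonIncreasing (M ∷ r)
  block-nonIncreasing xs r≤M M<x sub (refl ∷ s) with All-resp-⊆ s r≤M
  ... | b≤M ∷ [] = b≤M
  block-nonIncreasing {M} {r} {x} xs r≤M M<x sub {a} {b} (_ ∷ʳ s) with b ≤? a | All-resp-⊆ s r≤M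
  ... | yes b≤a | _ = b≤a
  ... | no b≰a  | _ ∷ b≤M ∷ [] =
    ⊥-elim (no3124 (≰⇒> b≰a) (below (⊆-trans (refl ∷ a ∷ʳ refl ∷ x ∷ʳ []) Mabx) b≤M) M<x Mabx)
    where
    Mabx : (M ∷ a ∷ b ∷ x ∷ []) ⊆ σ
    Mabx = ⊆-trans (refl ∷ ++⁺ s (refl ∷ []⊆-universal xs)) sub

  -- Scanning σ as Φ₂ does, at the left-to-right maximum M with the current
  -- block word w (reversed) and the unread suffix xs: the remaining path has
  -- as many peaks as the remaining suffix M w xs has ascents.
  scan : ∀ xs {M} w {prev} → prev < M → All (_≤ M) w → (M ∷ w ʳ++ xs) ⊆ σ →
         peaks (phiGo prev (blocksGo M w xs)) ≡ ascents (M ∷ w ʳ++ xs)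
  scan [] w prev<M w≤M sub =
    peaks-last-block (reverse w) prev<M (All-reverse w w≤M) (block-noTwoLarger (All-reverse w w≤M) sub)
  scan (x ∷ xs) {M} w prev<M w≤M sub with M <? x
  ... | no M≮x = scan xs (x ∷ w) prev<M (≮⇒≥ M≮x ∷ w≤M) sub
  ... | yes M<x = begin
    peaks (phiGo _ ((M , reverse w) ∷ blocksGo x [] xs))
      ≡⟨ peaks-inner-block (reverse w) (blocksGo x [] xs) prev<M (blocksGo-nonempty x [] xs) ⟩
    suc (peaks (phiGo M (blocksGo x [] xs)))
      ≡⟨ cong suc (scan xs [] M<x [] (⊆-trans (++⁺ˡ (M ∷ reverse w) ⊆-refl) sub′)) ⟩
    suc (ascents (x ∷ xs))
      ≡⟨ sym (ascents-run M (reverse w) xs (block-nonIncreasing xs w′≤M M<x sub′) Mw′<x) ⟩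
    ascents (M ∷ reverse w ++ x ∷ xs)
      ≡⟨ cong (ascents ∘ (M ∷_)) (sym (ʳ++-defn w)) ⟩
    ascents (M ∷ w ʳ++ x ∷ xs) ∎
    where
    open ≡-Reasoning
    w′≤M : All (_≤ M) (reverse w)
    w′≤M = All-reverse w w≤M
    Mw′<x : All (_< x) (M ∷ reverse w)
    Mw′<x = M<x ∷ All.map (λ e≤M → ≤-<-trans e≤M M<x) w′≤M
    sub′ : (M ∷ reverse w ++ x ∷ xs) ⊆ σ
    sub′ = subst (λ l → (M ∷ l) ⊆ σ) (ʳ++-defn w) sub

-- Proposition 18.
proposition18 : (σ : List ℕ) → IsPerm σ → 1 ≤ length σ → AvT2 σ → ascents σ ≡ peaks (Φ₂ σ)
proposition18 []       _    () _
proposition18 (x ∷ xs) perm _  (avoids3124 , _ , avoids4123 , avoids4132) =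
  sym (InAvT2.scan avoids3124 avoids4123 avoids4132 (perm-unique perm)
                   xs [] (perm-positive perm) [] ⊆-refl)
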